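{- For all ICTL formulae $\varphi,\psi$, the following formulae are valid (where $\alpha\leftrightarrow\beta$ abbreviates $(\alpha\to\beta)\wedge(\beta\to\alpha)$): (1) $\mathsf{E}(\varphi\mathsf{U}\psi)\leftrightarrow\psi\vee(\varphi\wedge\mathsf{E}\mathsf{X}\,\mathsf{E}(\varphi\mathsf{U}\psi))$; (2) $\mathsf{E}(\varphi\mathsf{R}\psi)\leftrightarrow\psi\wedge(\varphi\vee\mathsf{E}\mathsf{X}\,\mathsf{E}(\varphi\mathsf{R}\psi))$; (3) $\psi\vee(\varphi\wedge\mathsf{A}\mathsf{X}\,\mathsf{A}(\varphi\mathsf{U}\psi))\to\mathsf{A}(\varphi\mathsf{U}\psi)$; (4) $\psi\wedge(\varphi\vee\mathsf{A}\mathsf{X}\,\mathsf{A}(\varphi\mathsf{R}\psi))\to\mathsf{A}(\varphi\mathsf{R}\psi)$.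
   Context: Fix a countable set $\mathcal P$ of atomic propositions. ICTL formulae are given by the grammar $\varphi,\psi ::= p\mid\bot\mid\varphi\wedge\psi\mid\varphi\vee\psi\mid\varphi\to\psi\mid \mathsf{E}\mathsf{X}\varphi\mid\mathsf{E}(\varphi\mathsf{U}\psi)\mid\mathsf{E}(\varphi\mathsf{R}\psi)\mid\mathsf{A}\mathsf{X}\varphi\mid\mathsf{A}(\varphi\mathsf{U}\psi)\mid\mathsf{A}(\varphi\mathsf{R}\psi)$ with $p\in\mathcal P$. A birelational frame is $\langle W,P,R\rangle$ with $W$ a non-empty countable set, $P$ a preorder on $W$, $R$ a serial relation on $W$, satisfying for all $x,y,z$: (C1) if $x\,R\,y$ and $y\,P\,z$ then there is $u$ with $x\,P\,u$ and $u\,R\,z$; (C2) if $x\,P\,z$ and $x\,R\,y$ then there is $u$ with $y\,P\,u$ and $z\,R\,u$. A path is an infinite sequence $\rho_0,\rho_1,\ldots$ with $\rho_i\,R\,\rho_{i+1}$ for all $i$. A birelational model $\langle W,P,R,\mathcal V\rangle$ adds $\mathcal V:W\to2^{\mathcal P}$ with $w\,P\,w'\Rightarrow\mathcal V(w)\subseteq\mathcal V(w')$. Satisfaction: $w\models p$ iff $p\in\mathcal V(w)$; $w\not\models\bot$; $\wedge,\vee$ pointwise; $w\models\alpha\to\beta$ iff for every $w'$ with $w\,P\,w'$, $w'\models\alpha$ implies $w'\models\beta$; $w\models\mathsf{E}\mathsf{X}\alpha$ iff there is a path $\rho$ with $\rho_0=w$ and $\rho_1\models\alpha$; $w\models\mathsf{E}(\alpha\mathsf{U}\beta)$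 iff there is a path $\rho$ with $\rho_0=w$ and $j\ge0$ with $\rho_j\models\beta$ and $\rho_i\models\alpha$ for all $0\le i<j$; $w\models\mathsf{E}(\alpha\mathsf{R}\beta)$ iff there is a path $\rho$ with $\rho_0=w$ such that either $\rho_i\models\beta$ for all $i\in\mathbb N$ or there is $j\ge0$ with $\rho_j\models\alpha$ and $\rho_i\models\beta$ for all $0\le i\le j$; $w\models\mathsf{A}\mathsf{X}\alpha$ iff for every $w'$ with $w\,P\,w'$ and every path $\rho$ with $\rho_0=w'$, $\rho_1\models\alpha$; $w\models\mathsf{A}(\alpha\mathsf{U}\beta)$ iff for every $w'$ with $w\,P\,w'$ and every path $\rho$ with $\rho_0=w'$ there is $j\ge0$ with $\rho_j\models\beta$ and $\rho_i\models\alpha$ for $0\le i<j$; $w\models\mathsf{A}(\alpha\mathsf{R}\beta)$ iff for every $w'$ with $w\,P\,w'$ and every path $\rho$ with $\rho_0=w'$, either $\rho_i\models\beta$ for all $i$ or there is $j\ge0$ with $\rho_j\models\alpha$ and $\rho_i\models\beta$ for all $0\le i\le j$. A formula is valid iff it is satisfied at every world of every birelational model. -}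

module Defs where

open import Data.Nat using (ℕ; zero; suc; _≤_; _<_)
open import Data.Product using (Σ; ∃; _×_; _,_)
open import Data.Sum using (_⊎_)
open import Data.Empty using (⊥)
open import Function.Definitions using (Injective)
open import Relation.Binary.PropositionalEquality using (_≡_)

Atom : Set
Atom = ℕ

data Form : Set where
  atom : Atom → Form
  ⊥'   : Form
  _∧'_ : Form → Form → Form
  _∨'_ : Form → Form → Form
  _⇒'_ : Form → Form → Form
  EX   : Form → Form
  EU   : Form → Form → Form
  ER   : Form → Form → Form
  AX   : Form → Form
  AU   : Form → Form → Form
  AR   : Form → Form → Form

infixr 6 _∧'_
infixr 5 _∨'_
infixr 4 _⇒'_

_⇔'_ : Form → Form → Form
φ ⇔' ψ = (φ ⇒' ψ) ∧' (ψ ⇒' φ)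

infix 3 _⇔'_

record Frame : Set₁ where
  field
    W       : Set
    point   : W
    enc     : W → ℕ
    enc-inj : Injective _≡_ _≡_ enc
    P       : W → W → Set
    R       : W → W → Set
    P-refl  : ∀ x → P x x
    P-trans : ∀ {x y z} → P x y → P y z → P x z
    R-serial : ∀ x → Σ W (λ y → R x y)
    C1 : ∀ {x y z} → R x y → P y z → Σ W (λ u → P x u × R u z)
    C2 : ∀ {x y z} → P x z → R x y → Σ W (λ u → P y u × R z u)

record Model : Set₁ where
  field
    frame : Frame
  open Frame frame public
  field
    V      : W → Atom → Set
    V-mono : ∀ {w w'} → P w w' → ∀ p → V w p → V w' p

module _ (M : Model) where
  open Model M

  record Path : Set where
    constructor mkPath
    field
      at   : ℕ → W
      step : ∀ i → R (at i) (at (suc i))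
  open Path public

  _⊨_ : W → Form → Set
  w ⊨ atom p  = V w p
  w ⊨ ⊥'      = ⊥
  w ⊨ (φ ∧' ψ) = (w ⊨ φ) × (w ⊨ ψ)
  w ⊨ (φ ∨' ψ) = (w ⊨ φ) ⊎ (w ⊨ ψ)
  w ⊨ (φ ⇒' ψ) = ∀ w' → P w w' → w' ⊨ φ → w' ⊨ ψ
  w ⊨ EX φ    = Σ Path λ ρ → (at ρ 0 ≡ w) × (at ρ 1 ⊨ φ)
  w ⊨ EU φ ψ  = Σ Path λ ρ → (at ρ 0 ≡ w) ×
                  Σ ℕ λ j → (at ρ j ⊨ ψ) × (∀ i → i < j → at ρ i ⊨ φ)
  w ⊨ ER φ ψ  = Σ Path λ ρ → (at ρ 0 ≡ w) ×
                  ((∀ i → at ρ i ⊨ ψ) ⊎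
                   Σ ℕ λ j → (at ρ j ⊨ φ) × (∀ i → i ≤ j → at ρ i ⊨ ψ))
  w ⊨ AX φ    = ∀ w' → P w w' → (ρ : Path) → at ρ 0 ≡ w' → at ρ 1 ⊨ φ
  w ⊨ AU φ ψ  = ∀ w' → P w w' → (ρ : Path) → at ρ 0 ≡ w' →
                  Σ ℕ λ j → (at ρ j ⊨ ψ) × (∀ i → i < j → at ρ i ⊨ φ)
  w ⊨ AR φ ψ  = ∀ w' → P w w' → (ρ : Path) → at ρ 0 ≡ w' →
                  ((∀ i → at ρ i ⊨ ψ) ⊎
                   Σ ℕ λ j → (at ρ j ⊨ φ) × (∀ i → i ≤ j → at ρ i ⊨ ψ))

Valid : Form → Set₁
Valid φ = (M : Model) (w : Model.W M) → _⊨_ M w φ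

-- Each law is the one-step unfolding of "until"/"release" along a path, combined with the facts that a path
-- splits into its first step and its tail and that a step followed by any path is a path (seriality makes
-- every world the start of some path). The universal operators quantify over P-larger worlds as well, so
-- (3) and (4) also need persistence of satisfaction along P; for the path operators persistence rests on
-- (C2), which lets a path be simulated step by step from any P-larger start.
module Submission where

open import Defs hiding (_⊨_)
open import Data.Nat using (ℕ; zero; suc; _≤_; _<_; z≤n; s≤s)
open import Data.Product as Product using (Σ; _×_; _,_; proj₁; proj₂)
open import Data.Sum as Sum using (_⊎_; inj₁; inj₂)
open import Function using (_∘_)
open import Relation.Binary.PropositionalEquality using (_≡_; refl)

-- Stated for the predicates (λ i → at ρ i ⊨ φ) and (λ i → at ρ i ⊨ ψ), these are definitionally the
-- path conditions in the semantics of the U and R operators.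
Until : (ℕ → Set) → (ℕ → Set) → Set
Until a b = Σ ℕ λ j → b j × (∀ i → i < j → a i)

Release : (ℕ → Set) → (ℕ → Set) → Set
Release a b = (∀ i → b i) ⊎ Σ ℕ λ j → a j × (∀ i → i ≤ j → b i)

module _ {a b : ℕ → Set} where

  until-unfold : Until a b → b 0 ⊎ (a 0 × Until (a ∘ suc) (b ∘ suc))
  until-unfold (zero  , bj , _)  = inj₁ bj
  until-unfold (suc j , bj , a<) = inj₂ (a< 0 (s≤s z≤n) , j , bj , λ i i<j → a< (suc i) (s≤s i<j))

  until-fold : b 0 ⊎ (a 0 × Until (a ∘ suc) (b ∘ suc)) → Until a b
  until-fold (inj₁ b0)                 = 0 , b0 , λ _ ()
  until-fold (inj₂ (a0 , j , bj , a<)) = suc j , bj , λ where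
    zero    _         → a0
    (suc i) (s≤s i<j) → a< i i<j

  release-unfold : Release a b → b 0 × (a 0 ⊎ Release (a ∘ suc) (b ∘ suc))
  release-unfold (inj₁ b∀)                = b∀ 0 , inj₂ (inj₁ (b∀ ∘ suc))
  release-unfold (inj₂ (zero  , aj , b≤)) = b≤ 0 z≤n , inj₁ aj
  release-unfold (inj₂ (suc j , aj , b≤)) =
    b≤ 0 z≤n , inj₂ (inj₂ (j , aj , λ i i≤j → b≤ (suc i) (s≤s i≤j)))

  release-fold : b 0 × (a 0 ⊎ Release (a ∘ suc) (b ∘ suc)) → Release a b
  release-fold (b0 , inj₁ a0)                = inj₂ (0 , a0 , λ { zero z≤n → b0 })
  release-fold (b0 , inj₂ (inj₁ b∀))         = inj₁ λ where
    zero    → b0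
    (suc i) → b∀ i
  release-fold (b0 , inj₂ (inj₂ (j , aj , b≤))) = inj₂ (suc j , aj , λ where
    zero    _         → b0
    (suc i) (s≤s i≤j) → b≤ i i≤j)

module _ {a a′ b b′ : ℕ → Set} (f : ∀ i → a i → a′ i) (g : ∀ i → b i → b′ i) where

  until-map : Until a b → Until a′ b′
  until-map (j , bj , a<) = j , g j bj , λ i i<j → f i (a< i i<j)

  release-map : Release a b → Release a′ b′
  release-map (inj₁ b∀)            = inj₁ λ i → g i (b∀ i)
  release-map (inj₂ (j , aj , b≤)) = inj₂ (j , f j aj , λ i i≤j → g i (b≤ i i≤j))

module Semantics (M : Model) where
  open Model M

  _⊨_ : W → Form → Set
  _⊨_ = Defs._⊨_ M

  infix 4 _⊨_

  tail : Path M → Path M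
  tail ρ = mkPath (at ρ ∘ suc) (step ρ ∘ suc)

  cons : (w : W) (σ : Path M) → R w (at σ 0) → Path M
  cons w σ r = mkPath prefixed stepped
    where
    prefixed : ℕ → W
    prefixed zero    = w
    prefixed (suc i) = at σ i

    stepped : ∀ i → R (prefixed i) (prefixed (suc i))
    stepped zero    = r
    stepped (suc i) = step σ i

  serialPath : W → Path M
  serialPath w = mkPath world (proj₂ ∘ R-serial ∘ world)
    where
    world : ℕ → W
    world zero    = w
    world (suc i) = proj₁ (R-serial (world i))

  module _ (ρ : Path M) {v : W} (p : P (at ρ 0) v) where

    private
      above : ∀ i → Σ W (P (at ρ i))
      above zero    = v , p
      above (suc i) = Product.map₂ proj₁ (C2 (proj₂ (above i)) (step ρ i))

    lift : Path M
    lift = mkPath (proj₁ ∘ above) λ i → proj₂ (proj₂ (C2 (proj₂ (above i)) (step ρ i)))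

    lift-above : ∀ i → P (at ρ i) (at lift i)
    lift-above = proj₂ ∘ above

  EX-intro : ∀ φ {w v} → R w v → v ⊨ φ → w ⊨ EX φ
  EX-intro φ {v = v} r vφ = cons _ (serialPath v) r , refl , vφ

  EX-successor : ∀ φ {w} → w ⊨ EX φ → Σ W λ v → R w v × v ⊨ φ
  EX-successor φ (ρ , refl , vφ) = at ρ 1 , step ρ 0 , vφ

  ⊨-mono : ∀ φ {w w′} → P w w′ → w ⊨ φ → w′ ⊨ φ
  ⊨-mono (atom p)  w≤w′ = V-mono w≤w′ p
  ⊨-mono ⊥'        w≤w′ ()
  ⊨-mono (φ ∧' ψ)  w≤w′ = Product.map (⊨-mono φ w≤w′) (⊨-mono ψ w≤w′)
  ⊨-mono (φ ∨' ψ)  w≤w′ = Sum.map (⊨-mono φ w≤w′) (⊨-mono ψ w≤w′)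
  ⊨-mono (φ ⇒' ψ)  w≤w′ h v = h v ∘ P-trans w≤w′
  ⊨-mono (EX φ)    w≤w′ ex with EX-successor φ ex
  ... | v , r , vφ with C2 w≤w′ r
  ...   | u , v≤u , r′ = EX-intro φ r′ (⊨-mono φ v≤u vφ)
  ⊨-mono (EU φ ψ)  w≤w′ (ρ , refl , u) =
    lift ρ w≤w′ , refl , until-map (along φ) (along ψ) u
    where
    along : ∀ χ i → at ρ i ⊨ χ → at (lift ρ w≤w′) i ⊨ χ
    along χ i = ⊨-mono χ (lift-above ρ w≤w′ i)
  ⊨-mono (ER φ ψ)  w≤w′ (ρ , refl , r) =
    lift ρ w≤w′ , refl , release-map (along φ) (along ψ) r
    where
    along : ∀ χ i → at ρ i ⊨ χ → at (lift ρ w≤w′) i ⊨ χ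
    along χ i = ⊨-mono χ (lift-above ρ w≤w′ i)
  ⊨-mono (AX φ)    w≤w′ h v = h v ∘ P-trans w≤w′
  ⊨-mono (AU φ ψ)  w≤w′ h v = h v ∘ P-trans w≤w′
  ⊨-mono (AR φ ψ)  w≤w′ h v = h v ∘ P-trans w≤w′

  A-elim : ∀ {w} {X : Path M → Set} → (∀ w′ → P w w′ → (ρ : Path M) → at ρ 0 ≡ w′ → X ρ) →
           (ρ : Path M) → at ρ 0 ≡ w → X ρ
  A-elim {w} h = h w (P-refl w)

  module _ (φ ψ : Form) where

    EU-unfold : ∀ {w} → w ⊨ EU φ ψ → w ⊨ ψ ∨' (φ ∧' EX (EU φ ψ))
    EU-unfold (ρ , refl , u) =
      Sum.map₂ (Product.map₂ λ u′ → ρ , refl , tail ρ , refl , u′) (until-unfold u)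

    EU-fold : ∀ {w} → w ⊨ ψ ∨' (φ ∧' EX (EU φ ψ)) → w ⊨ EU φ ψ
    EU-fold {w} (inj₁ wψ) = serialPath w , refl , until-fold (inj₁ wψ)
    EU-fold {w} (inj₂ (wφ , ex)) with EX-successor (EU φ ψ) ex
    ... | _ , r , σ , refl , u = cons w σ r , refl , until-fold (inj₂ (wφ , u))

    ER-unfold : ∀ {w} → w ⊨ ER φ ψ → w ⊨ ψ ∧' (φ ∨' EX (ER φ ψ))
    ER-unfold (ρ , refl , r) =
      Product.map₂ (Sum.map₂ λ r′ → ρ , refl , tail ρ , refl , r′) (release-unfold r)

    ER-fold : ∀ {w} → w ⊨ ψ ∧' (φ ∨' EX (ER φ ψ)) → w ⊨ ER φ ψ
    ER-fold {w} (wψ , inj₁ wφ) = serialPath w , refl , release-fold (wψ , inj₁ wφ)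
    ER-fold {w} (wψ , inj₂ ex) with EX-successor (ER φ ψ) ex
    ... | _ , r , σ , refl , r′ = cons w σ r , refl , release-fold (wψ , inj₂ r′)

    AU-fold : ∀ {w} → w ⊨ ψ ∨' (φ ∧' AX (AU φ ψ)) → w ⊨ AU φ ψ
    AU-fold h _ w≤w′ ρ refl =
      until-fold (Sum.map₂ (Product.map₂ on-tail) (⊨-mono (ψ ∨' (φ ∧' AX (AU φ ψ))) w≤w′ h))
      where
      on-tail : at ρ 0 ⊨ AX (AU φ ψ) → Until (λ i → at ρ (suc i) ⊨ φ) (λ i → at ρ (suc i) ⊨ ψ)
      on-tail ax = A-elim (A-elim ax ρ refl) (tail ρ) refl

    AR-fold : ∀ {w} → w ⊨ ψ ∧' (φ ∨' AX (AR φ ψ)) → w ⊨ AR φ ψ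
    AR-fold h _ w≤w′ ρ refl =
      release-fold (Product.map₂ (Sum.map₂ on-tail) (⊨-mono (ψ ∧' (φ ∨' AX (AR φ ψ))) w≤w′ h))
      where
      on-tail : at ρ 0 ⊨ AX (AR φ ψ) → Release (λ i → at ρ (suc i) ⊨ φ) (λ i → at ρ (suc i) ⊨ ψ)
      on-tail ax = A-elim (A-elim ax ρ refl) (tail ρ) refl

open Semantics using (EU-unfold; EU-fold; ER-unfold; ER-fold; AU-fold; AR-fold)

proposition3 : (φ ψ : Form) →
    Valid (EU φ ψ ⇔' ψ ∨' (φ ∧' EX (EU φ ψ))) ×
    Valid (ER φ ψ ⇔' ψ ∧' (φ ∨' EX (ER φ ψ))) ×
    Valid (ψ ∨' (φ ∧' AX (AU φ ψ)) ⇒' AU φ ψ) ×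
    Valid (ψ ∧' (φ ∨' AX (AR φ ψ)) ⇒' AR φ ψ)
proposition3 φ ψ =
  (λ M _ → (λ _ _ → EU-unfold M φ ψ) , (λ _ _ → EU-fold M φ ψ)) ,
  (λ M _ → (λ _ _ → ER-unfold M φ ψ) , (λ _ _ → ER-fold M φ ψ)) ,
  (λ M _ _ _ → AU-fold M φ ψ) ,
  (λ M _ _ _ → AR-fold M φ ψ)
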